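{- Let $\lambda=(p_1,\dots,p_k)$ be a partition of $n$ and $\dot\sigma,\dot\tau\in\mathfrak{S}_{I_\lambda}$. Then for every $\tau\in\mathrm{p}^{ -1}(\dot\tau)$, $$\langle 0|\,\mathtt{a}_{\dot\sigma(n)}\cdots\mathtt{a}_{\dot\sigma(1)}\,\mathtt{a}_{\dot\tau(1)}^{\dag}\cdots\mathtt{a}_{\dot\tau(n)}^{\dag}\,|0\rangle = \mathrm{v}_n(C_{\dot\sigma},C_\tau).$$
   Context: The operators $\mathtt{a}_i,\mathtt{a}_i^{\dag}$ satisfy $\mathtt{a}_i\mathtt{a}_j^{\dag} = q_{i,j}\mathtt{a}_j^{\dag}\mathtt{a}_i+\delta_{i,j}$, act on a module with vacuum $|0\rangle$, $\mathtt{a}_i|0\rangle=0$, $\langle 0|\mathtt{a}_i^{\dag}=0$, $\langle 0|0\rangle=1$. For $s\in[n]$, $\dot s := i$ if $p_1+\dots+p_{i-1}<s\le p_1+\dots+p_i$. $I_\lambda$ is the multiset with $p_i$ copies of $i$, $\mathfrak{S}_{I_\lambda}$ its set of permutations (words $\dot\sigma=\dot\sigma(1)\cdots\dot\sigma(n)$), and $\mathrm{p}:\mathfrak{S}_n\to\mathfrak{S}_{I_\lambda}$, $\mathrm{p}(\sigma)=\dot{\sigma(1)}\cdots\dot{\sigma(n)}$. Chambers $C_\sigma = \{x\in\mathbb{R}^n\mid x_{\sigma(1)}<\dots<x_{\sigma(n)}\}$; the variable $q_{\dot s,\dot t}$ is assigned to the half-space $\{x_s<x_t\}$, so $\mathrm{v}_n(C_\sigma,C_\tau)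 = \prod_{i<j,\ \tau^{ -1}\sigma(i)>\tau^{ -1}\sigma(j)} q_{\dot{\sigma(i)},\dot{\sigma(j)}}$, extended bilinearly; and $C_{\dot\sigma} = \sum_{\sigma\in\mathrm{p}^{ -1}(\dot\sigma)}C_\sigma$. -}

module Defs where

open import Level using (Level; _⊔_) renaming (suc to lsuc)
open import Data.Nat using (ℕ; zero; suc; _>_; _≥_)
open import Data.Fin using (Fin; zero; suc; splitAt; _<_; _<?_; _≟_)
open import Data.Fin.Properties using (all?)
open import Data.Fin.Permutation using (Permutation′; _⟨$⟩ʳ_; _⟨$⟩ˡ_)
open import Data.Nat.ListAction using (sum)
open import Data.List using (List; []; _∷_; length; map; concatMap; filter; foldr; tabulate)
open import Data.List.Relation.Unary.All using (All)
open import Data.List.Relation.Unary.Linked using (Linked)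
open import Data.List.Relation.Binary.Permutation.Propositional using (_↭_)
open import Data.List.Base using (allFin)
open import Data.Product using (_×_; _,_; proj₁; proj₂)
open import Data.Sum using ([_,_]′)
open import Function using (_∘_; const)
open import Relation.Binary.PropositionalEquality using (_≡_)
open import Relation.Nullary using (Dec; yes; no; ¬_)
open import Relation.Nullary.Decidable using (_→-dec_; _×-dec_)
open import Algebra.Bundles using (CommutativeRing)
open import Algebra.Module.Bundles using (Module)

-- Partitions  λ = (p₁ , … , p_k)  given as a list of parts.
-- A partition: all parts positive and weakly decreasing.
-- n = sum of parts, k = number of parts.

IsPartition : List ℕ → Set
IsPartition ps = All (_> 0) ps × Linked _≥_ ps

-- the map  s ↦ ṡ  : Fin n → Fin k  (0-indexed), i.e.
-- ṡ = i  iff  p₁+…+p_{i-1} < s ≤ p₁+…+p_i  (with s, i shifted by one).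
dot : (ps : List ℕ) → Fin (sum ps) → Fin (length ps)
dot []       ()
dot (p ∷ ps) s = [ const zero , (λ t → suc (dot ps t)) ]′ (splitAt p s)

-- The multiset I_λ, written as the word 1^{p₁} 2^{p₂} … k^{p_k}.
I : (ps : List ℕ) → List (Fin (length ps))
I ps = tabulate (dot ps)

In𝔖I : (ps : List ℕ) → (Fin (sum ps) → Fin (length ps)) → Set
In𝔖I ps w = tabulate w ↭ I ps

InFibreP : (ps : List ℕ) → (Fin (sum ps) → Fin (length ps)) → Permutation′ (sum ps) → Set
InFibreP ps w τ = ∀ i → dot ps (τ ⟨$⟩ʳ i) ≡ w i

-- Enumeration of all maps Fin n → Fin m, and of 𝔖_n as the injective ones.

consF : ∀ {n m} → Fin m → (Fin n → Fin m) → Fin (suc n) → Fin m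
consF i f zero    = i
consF i f (suc x) = f x

allMaps : (n m : ℕ) → List (Fin n → Fin m)
allMaps zero    m = (λ ()) ∷ []
allMaps (suc n) m = concatMap (λ f → map (λ i → consF i f) (allFin m)) (allMaps n m)

IsInjective : ∀ {n} → (Fin n → Fin n) → Set
IsInjective σ = ∀ i j → σ i ≡ σ j → i ≡ j

InFibre : (ps : List ℕ) → (Fin (sum ps) → Fin (length ps)) → (Fin (sum ps) → Fin (sum ps)) → Set
InFibre ps w σ = IsInjective σ × (∀ i → dot ps (σ i) ≡ w i)

inFibre? : (ps : List ℕ) (w : Fin (sum ps) → Fin (length ps)) → ∀ σ → Dec (InFibre ps w σ)
inFibre? ps w σ =
  all? (λ i → all? (λ j → (σ i ≟ σ j) →-dec (i ≟ j)))
  ×-dec all? (λ i → dot ps (σ i) ≟ w i)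

-- the list p⁻¹(w) ⊆ 𝔖_n  (each permutation exactly once, in one-line form)
fibre : (ps : List ℕ) → (Fin (sum ps) → Fin (length ps)) → List (Fin (sum ps) → Fin (sum ps))
fibre ps w = filter (inFibre? ps w) (allMaps (sum ps) (sum ps))

pairs : (n : ℕ) → List (Fin n × Fin n)
pairs n = concatMap (λ i → map (i ,_) (allFin n)) (allFin n)

module Weights {c ℓ} (R : CommutativeRing c ℓ) where
  open CommutativeRing R

  Σ : ∀ {a} {A : Set a} → List A → (A → Carrier) → Carrier
  Σ xs f = foldr (λ x r → f x + r) 0# xs

  Π : ∀ {a} {A : Set a} → List A → (A → Carrier) → Carrier
  Π xs f = foldr (λ x r → f x * r) 1# xs

  module _ (ps : List ℕ) (q : Fin (length ps) → Fin (length ps) → Carrier) where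

    -- v_n(C_σ, C_τ) = ∏_{i<j, τ⁻¹σ(i) > τ⁻¹σ(j)} q_{σ(i)˙, σ(j)˙}
    inversionPair : (σ : Fin (sum ps) → Fin (sum ps)) → Permutation′ (sum ps)
                  → Fin (sum ps) × Fin (sum ps) → Set
    inversionPair σ τ (i , j) = (i < j) × (τ ⟨$⟩ˡ σ j < τ ⟨$⟩ˡ σ i)

    inversionPair? : ∀ σ τ x → Dec (inversionPair σ τ x)
    inversionPair? σ τ (i , j) = (i <? j) ×-dec (τ ⟨$⟩ˡ σ j <? τ ⟨$⟩ˡ σ i)

    vChamber : (σ : Fin (sum ps) → Fin (sum ps)) → Permutation′ (sum ps) → Carrier
    vChamber σ τ =
      Π (filter (inversionPair? σ τ) (pairs (sum ps)))
        (λ x → q (dot ps (σ (proj₁ x))) (dot ps (σ (proj₂ x))))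

    -- v_n(C_w, C_τ) = Σ_{σ ∈ p⁻¹(w)} v_n(C_σ, C_τ)   (bilinear extension)
    vWord : (Fin (sum ps) → Fin (length ps)) → Permutation′ (sum ps) → Carrier
    vWord w τ = Σ (fibre ps w) (λ σ → vChamber σ τ)

kronecker : ∀ {c ℓ m ℓm k} {R : CommutativeRing c ℓ} (M : Module R m ℓm) →
            Fin k → Fin k → Module.Carrierᴹ M → Module.Carrierᴹ M
kronecker M i j x with i ≟ j
... | yes _ = x
... | no _  = Module.0ᴹ M

record QRep {c ℓ} (R : CommutativeRing c ℓ) (m ℓm : Level) (k : ℕ)
            (q : Fin k → Fin k → CommutativeRing.Carrier R)
            : Set (c ⊔ ℓ ⊔ lsuc (m ⊔ ℓm)) where
  open CommutativeRing R
  field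
    M : Module R m ℓm
  open Module M using (Carrierᴹ; _≈ᴹ_; _+ᴹ_; _*ₗ_; 0ᴹ)

  field
    a a† : Fin k → Carrierᴹ → Carrierᴹ
    vac  : Carrierᴹ
    bra  : Carrierᴹ → Carrier
    a-cong   : ∀ i {x y} → x ≈ᴹ y → a i x ≈ᴹ a i y
    a-+      : ∀ i x y → a i (x +ᴹ y) ≈ᴹ (a i x +ᴹ a i y)
    a-*      : ∀ i r x → a i (r *ₗ x) ≈ᴹ (r *ₗ a i x)
    a†-cong  : ∀ i {x y} → x ≈ᴹ y → a† i x ≈ᴹ a† i y
    a†-+     : ∀ i x y → a† i (x +ᴹ y) ≈ᴹ (a† i x +ᴹ a† i y)
    a†-*     : ∀ i r x → a† i (r *ₗ x) ≈ᴹ (r *ₗ a† i x)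
    bra-cong : ∀ {x y} → x ≈ᴹ y → bra x ≈ bra y
    bra-+    : ∀ x y → bra (x +ᴹ y) ≈ (bra x + bra y)
    bra-*    : ∀ r x → bra (r *ₗ x) ≈ (r * bra x)
    comm     : ∀ i j x → a i (a† j x) ≈ᴹ ((q i j *ₗ a† j (a i x)) +ᴹ kronecker M i j x)
    a-vac    : ∀ i → a i vac ≈ᴹ 0ᴹ
    bra-a†   : ∀ i x → bra (a† i x) ≈ 0#
    bra-vac  : bra vac ≈ 1#

  creates : List (Fin k) → Carrierᴹ → Carrierᴹ
  creates []       x = x
  creates (t ∷ ts) x = a† t (creates ts x)

  -- a_{s_n} ⋯ a_{s₂} a_{s₁} x
  annihilates : List (Fin k) → Carrierᴹ → Carrierᴹ
  annihilates []       x = x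
  annihilates (s ∷ ss) x = annihilates ss (a s x)

  -- ⟨0| a_{s_n} ⋯ a_{s₁} a†_{t₁} ⋯ a†_{t_n} |0⟩
  vev : List (Fin k) → List (Fin k) → Carrier
  vev ss ts = bra (annihilates ss (creates ts vac))

module Submission where

-- Moving the innermost annihilator a_s rightwards through a†_{t₁} ⋯ a†_{tₙ} |0⟩ with the relation
-- a_s a†_t = q_{s,t} a†_t a_s + δ_{s,t} gives a sum over the creators a†_{t_l} with t_l = s of
-- ∏_{l′<l} q_{s,t_{l′}} times the string with a†_{t_l} removed; the term that reaches |0⟩ vanishes.
-- Iterating, the vacuum expectation value is a sum over complete contractions, i.e. over injections
-- σ of the annihilators into the particles with σ̇ = ṡ ∘ σ.  Numbering the particles so that the
-- l-th creator creates particle τ(l), the factors collected along σ are the q_{σ̇(i),σ̇(j)} over the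
-- pairs i < j whose order is reversed by τ⁻¹σ, which is v_n(C_σ, C_τ).  The induction keeps the
-- creation string fixed and marks the particles already contracted instead of deleting their
-- creators; the number of unmarked particles equals the number of remaining annihilators.

open import Level using (Level; _⊔_)
open import Data.Bool using (Bool; true; false; not; _∧_; _∨_; if_then_else_; T)
import Data.Bool as Bool
open import Data.Bool.Properties using (∧-assoc; T-not-≡)
open import Data.Empty using (⊥; ⊥-elim)
open import Data.Nat using (ℕ; zero; suc)
open import Data.Nat.Properties using (suc-injective)
open import Data.Fin using (Fin; zero; suc; _≟_; _<?_)
open import Data.Fin.Properties using (all?; <-irrefl) renaming (suc-injective to Fin-suc-injective)
open import Data.Fin.Permutation using (Permutation′; _⟨$⟩ʳ_; _⟨$⟩ˡ_; inverseˡ)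
open import Data.List using (List; []; _∷_; _++_; length; map; concatMap; filter; tabulate; allFin)
open import Data.Product using (_×_; _,_; proj₁; proj₂)
open import Data.Vec.Functional using () renaming (_∷_ to _◂_)
open import Function using (_∘_; id; _⇔_; mk⇔; Equivalence)
open import Relation.Nullary using (Dec; does; yes; no)
open import Relation.Nullary.Decidable using (_×-dec_; _→-dec_; does-⇔; dec-false; T?)
open import Relation.Unary using (Pred; Decidable)
open import Relation.Binary.PropositionalEquality as ≡ using (_≡_; _≗_)
open import Algebra.Bundles using (CommutativeMonoid; CommutativeRing)
open import Algebra.Module.Bundles using (Module)
open import Defs

mark : ∀ {n} → (Fin n → Bool) → Fin n → Fin n → Bool
mark u x y = does (y ≟ x) ∨ u y

unmarked : ∀ {n} → (Fin n → Bool) → ℕ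
unmarked {zero}  u = 0
unmarked {suc n} u = if u zero then unmarked (u ∘ suc) else suc (unmarked (u ∘ suc))

unmarked-mark : ∀ {n} (u : Fin n → Bool) x → u x ≡ false → unmarked u ≡ suc (unmarked (mark u x))
unmarked-mark u zero    ux≡false rewrite ux≡false = ≡.refl
unmarked-mark u (suc x) ux≡false rewrite unmarked-mark (u ∘ suc) x ux≡false with u zero
... | true  = ≡.refl
... | false = ≡.refl

unmarked≡0⇒marked : ∀ {n} (u : Fin n → Bool) → unmarked u ≡ 0 → ∀ y → u y ≡ true
unmarked≡0⇒marked {suc n} u none y with u zero in u₀
unmarked≡0⇒marked {suc n} u ()   y       | false
unmarked≡0⇒marked {suc n} u none zero    | true = u₀
unmarked≡0⇒marked {suc n} u none (suc y) | true = unmarked≡0⇒marked (u ∘ suc) none y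

unmarked-none : ∀ n → unmarked {n} (λ _ → false) ≡ n
unmarked-none zero    = ≡.refl
unmarked-none (suc n) = ≡.cong suc (unmarked-none n)

T-not-∧-does : ∀ {p} {P : Set p} b (P? : Dec P) → T (not b ∧ does P?) → b ≡ false × P
T-not-∧-does false (yes p) _  = ≡.refl , p
T-not-∧-does false (no _)  ()
T-not-∧-does true  _       ()

module BigOperators {c ℓ} (M : CommutativeMonoid c ℓ) where
  open CommutativeMonoid M
  open import Algebra.Properties.CommutativeMonoid.Sum M public
    using (sum; sum-cong-≋; sum-cong-≗; sum-permute; ∑-distrib-+; sum-replicate-zero)
  open import Relation.Binary.Reasoning.Setoid setoid

  -- For the two monoids of a ring this is definitionally Weights.Σ and Weights.Π.
  fold : ∀ {a} {A : Set a} → List A → (A → Carrier) → Carrier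
  fold xs f = Data.List.foldr (λ x r → f x ∙ r) ε xs

  fold-cong : ∀ {a} {A : Set a} (xs : List A) {f g : A → Carrier} →
              (∀ x → f x ≈ g x) → fold xs f ≈ fold xs g
  fold-cong []       f≈g = refl
  fold-cong (x ∷ xs) f≈g = ∙-cong (f≈g x) (fold-cong xs f≈g)

  fold-ε : ∀ {a} {A : Set a} (xs : List A) {f : A → Carrier} → (∀ x → f x ≈ ε) → fold xs f ≈ ε
  fold-ε []       f≈ε = refl
  fold-ε (x ∷ xs) f≈ε = trans (∙-cong (f≈ε x) (fold-ε xs f≈ε)) (identityˡ ε)

  fold-++ : ∀ {a} {A : Set a} (xs ys : List A) (f : A → Carrier) →
            fold (xs ++ ys) f ≈ fold xs f ∙ fold ys f
  fold-++ []       ys f = sym (identityˡ _)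
  fold-++ (x ∷ xs) ys f = trans (∙-congˡ (fold-++ xs ys f)) (sym (assoc _ _ _))

  fold-map : ∀ {a b} {A : Set a} {B : Set b} (h : A → B) (xs : List A) (f : B → Carrier) →
             fold (map h xs) f ≈ fold xs (f ∘ h)
  fold-map h []       f = refl
  fold-map h (x ∷ xs) f = ∙-congˡ (fold-map h xs f)

  fold-concatMap : ∀ {a b} {A : Set a} {B : Set b} (h : A → List B) (xs : List A) (f : B → Carrier) →
                   fold (concatMap h xs) f ≈ fold xs (λ x → fold (h x) f)
  fold-concatMap h []       f = refl
  fold-concatMap h (x ∷ xs) f = trans (fold-++ (h x) (concatMap h xs) f) (∙-congˡ (fold-concatMap h xs f))

  fold-tabulate : ∀ {a} {A : Set a} {n} (h : Fin n → A) (f : A → Carrier) →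
                  fold (tabulate h) f ≈ sum (f ∘ h)
  fold-tabulate {n = zero}  h f = refl
  fold-tabulate {n = suc n} h f = ∙-congˡ (fold-tabulate (h ∘ suc) f)

  fold-filter : ∀ {a p} {A : Set a} {P : Pred A p} (P? : Decidable P) (xs : List A) (f : A → Carrier) →
                fold (filter P? xs) f ≈ fold xs (λ x → if does (P? x) then f x else ε)
  fold-filter P? []       f = refl
  fold-filter P? (x ∷ xs) f with does (P? x)
  ... | true  = ∙-congˡ (fold-filter P? xs f)
  ... | false = trans (fold-filter P? xs f) (sym (identityˡ _))

  fold-∑-comm : ∀ {a} {A : Set a} {n} (xs : List A) (f : A → Fin n → Carrier) →
                fold xs (λ x → sum (f x)) ≈ sum (λ i → fold xs (λ x → f x i))
  fold-∑-comm {n = n} []       f = sym (sum-replicate-zero n)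
  fold-∑-comm         (x ∷ xs) f = begin
    sum (f x) ∙ fold xs (λ x → sum (f x))         ≈⟨ ∙-congˡ (fold-∑-comm xs f) ⟩
    sum (f x) ∙ sum (λ i → fold xs (λ x → f x i)) ≈⟨ ∑-distrib-+ (f x) _ ⟨
    sum (λ i → f x i ∙ fold xs (λ x → f x i))     ∎

  fold-allMaps : ∀ n N (f : (Fin (suc n) → Fin N) → Carrier) →
                 fold (allMaps (suc n) N) f ≈ fold (allMaps n N) (λ g → sum (λ x → f (consF x g)))
  fold-allMaps n N f = trans (fold-concatMap _ (allMaps n N) f)
    (fold-cong (allMaps n N) λ g → trans (fold-map _ (allFin N) f) (fold-tabulate id (λ x → f (consF x g))))

  sum-indicator : ∀ {n} (y₀ : Fin n) (v : Carrier) → sum (λ y → if does (y ≟ y₀) then v else ε) ≈ v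
  sum-indicator {suc n} zero     v = trans (∙-congˡ (sum-replicate-zero n)) (identityʳ v)
  sum-indicator {suc n} (suc y₀) v = trans (identityˡ _) (sum-indicator y₀ v)

  sum-unmarked-mark : ∀ {n} (u : Fin n → Bool) (h : Fin n → Carrier) x → u x ≡ false →
    sum (λ y → if not (u y) then h y else ε) ≈ h x ∙ sum (λ y → if not (mark u x y) then h y else ε)
  sum-unmarked-mark {n} u h x ux≡false = begin
    sum (λ y → if not (u y) then h y else ε) ≈⟨ sum-cong-≋ split ⟩
    sum (λ y → atX y ∙ rest y)              ≈⟨ ∑-distrib-+ atX rest ⟩
    sum atX ∙ sum rest                      ≈⟨ ∙-congʳ (sum-indicator x (h x)) ⟩
    h x ∙ sum rest                          ∎
    where
    atX rest : Fin n → Carrier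
    atX  y = if does (y ≟ x) then h x else ε
    rest y = if not (mark u x y) then h y else ε
    split : ∀ y → (if not (u y) then h y else ε) ≈ atX y ∙ rest y
    split y with y ≟ x
    ... | yes ≡.refl rewrite ux≡false = sym (identityʳ _)
    ... | no _ = sym (identityˡ _)

  sum-enumeration : ∀ {N m} (u : Fin N → Bool) (h : Fin N → Carrier) (g : Fin m → Fin N) →
    (∀ i j → g i ≡ g j → i ≡ j) → (∀ j → u (g j) ≡ false) → unmarked u ≡ m →
    sum (h ∘ g) ≈ sum (λ y → if not (u y) then h y else ε)
  sum-enumeration {N} {zero} u h g _ _ none = sym (trans (sum-cong-≋ marked) (sum-replicate-zero N))
    where
    marked : ∀ y → (if not (u y) then h y else ε) ≈ ε
    marked y rewrite unmarked≡0⇒marked u none y = refl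
  sum-enumeration {N} {suc m} u h g g-inj g-unmarked count = sym (begin
    sum (λ y → if not (u y) then h y else ε)                ≈⟨ sum-unmarked-mark u h (g zero) (g-unmarked zero) ⟩
    h (g zero) ∙ sum (λ y → if not (u′ y) then h y else ε)
      ≈⟨ ∙-congˡ (sum-enumeration u′ h (g ∘ suc) g′-inj g′-unmarked count′) ⟨
    h (g zero) ∙ sum (h ∘ g ∘ suc)                          ∎)
    where
    u′ : Fin N → Bool
    u′ = mark u (g zero)
    g′-inj : ∀ i j → g (suc i) ≡ g (suc j) → i ≡ j
    g′-inj i j eq = Fin-suc-injective (g-inj (suc i) (suc j) eq)
    g′-unmarked : ∀ j → u′ (g (suc j)) ≡ false
    g′-unmarked j with g (suc j) ≟ g zero
    ... | yes eq with () ← g-inj (suc j) zero eq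
    ... | no _   = g-unmarked (suc j)
    count′ : unmarked u′ ≡ m
    count′ = suc-injective (≡.trans (≡.sym (unmarked-mark u (g zero) (g-unmarked zero))) count)

module RingSums {c ℓ} (R : CommutativeRing c ℓ) where
  open CommutativeRing R
  module ∑ = BigOperators +-commutativeMonoid
  module ∏ = BigOperators *-commutativeMonoid
  open import Algebra.Properties.Semiring.Sum semiring public using (*-distribˡ-sum)

  if-cong : ∀ b {v w z : Carrier} → v ≈ w → (if b then v else z) ≈ (if b then w else z)
  if-cong true  v≈w = v≈w
  if-cong false v≈w = refl

  *-distribˡ-if : ∀ b r v → r * (if b then v else 0#) ≈ (if b then r * v else 0#)
  *-distribˡ-if true  r v = refl
  *-distribˡ-if false r v = zeroʳ r

  *-distribˡ-fold : ∀ {a} {X : Set a} r (xs : List X) f → r * ∑.fold xs f ≈ ∑.fold xs (λ x → r * f x)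
  *-distribˡ-fold r []       f = zeroʳ r
  *-distribˡ-fold r (x ∷ xs) f = trans (distribˡ r _ _) (+-congˡ (*-distribˡ-fold r xs f))

  if-fold-∧ : ∀ {a} {X : Set a} b {v} (xs : List X) (c : X → Bool) (w : X → Carrier) →
    (T b → v ≈ ∑.fold xs (λ g → if c g then w g else 0#)) →
    (if b then v else 0#) ≈ ∑.fold xs (λ g → if b ∧ c g then w g else 0#)
  if-fold-∧ true  xs c w v≈ = v≈ _
  if-fold-∧ false xs c w v≈ = sym (∑.fold-ε xs λ _ → refl)

module NormalOrdering {c ℓ m ℓm} (R : CommutativeRing c ℓ) {K : ℕ}
  {q : Fin K → Fin K → CommutativeRing.Carrier R} (A : QRep R m ℓm K q) where

  open CommutativeRing R hiding (zero)
  open RingSums R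
  open QRep A
  open Module M using (Carrierᴹ; _≈ᴹ_; _+ᴹ_; _*ₗ_; 0ᴹ; *ₗ-zeroˡ; ≈ᴹ-sym)
  open import Relation.Binary.Reasoning.Setoid setoid

  record LinearForm : Set (c ⊔ ℓ ⊔ m ⊔ ℓm) where
    field
      φ      : Carrierᴹ → Carrier
      φ-cong : ∀ {x y} → x ≈ᴹ y → φ x ≈ φ y
      φ-+    : ∀ x y → φ (x +ᴹ y) ≈ φ x + φ y
      φ-*    : ∀ r x → φ (r *ₗ x) ≈ r * φ x

    φ-0ᴹ : φ 0ᴹ ≈ 0#
    φ-0ᴹ = trans (φ-cong (≈ᴹ-sym (*ₗ-zeroˡ 0ᴹ))) (trans (φ-* 0# 0ᴹ) (zeroˡ _))

    φ-kronecker : ∀ s t x → φ (kronecker {k = K} M s t x) ≈ (if does (s ≟ t) then φ x else 0#)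
    φ-kronecker s t x with s ≟ t
    ... | yes _ = refl
    ... | no _  = φ-0ᴹ

  open LinearForm

  _∘a†_ : LinearForm → Fin K → LinearForm
  Φ ∘a† t = record
    { φ      = φ Φ ∘ a† t
    ; φ-cong = φ-cong Φ ∘ a†-cong t
    ; φ-+    = λ x y → trans (φ-cong Φ (a†-+ t x y)) (φ-+ Φ _ _)
    ; φ-*    = λ r x → trans (φ-cong Φ (a†-* t r x)) (φ-* Φ _ _)
    }

  _∘a_ : LinearForm → Fin K → LinearForm
  Φ ∘a s = record
    { φ      = φ Φ ∘ a s
    ; φ-cong = φ-cong Φ ∘ a-cong s
    ; φ-+    = λ x y → trans (φ-cong Φ (a-+ s x y)) (φ-+ Φ _ _)
    ; φ-*    = λ r x → trans (φ-cong Φ (a-* s r x)) (φ-* Φ _ _)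
    }

  braAfter : List (Fin K) → LinearForm
  braAfter []       = record { φ = bra ; φ-cong = bra-cong ; φ-+ = bra-+ ; φ-* = bra-* }
  braAfter (s ∷ ss) = braAfter ss ∘a s

  braAfter-annihilates : ∀ ss x → φ (braAfter ss) x ≡ bra (annihilates ss x)
  braAfter-annihilates []       x = ≡.refl
  braAfter-annihilates (s ∷ ss) x = braAfter-annihilates ss (a s x)

  creatorsExcept : ∀ {n} → (Fin n → Bool) → (Fin n → Fin K) → Carrierᴹ → Carrierᴹ
  creatorsExcept {zero}  u L x = x
  creatorsExcept {suc n} u L x = (if u zero then id else a† (L zero)) (creatorsExcept (u ∘ suc) (L ∘ suc) x)

  creatorsExcept-cong : ∀ {n} {u v : Fin n → Bool} {L L′ : Fin n → Fin K} x →
                        u ≗ v → L ≗ L′ → creatorsExcept u L x ≡ creatorsExcept v L′ x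
  creatorsExcept-cong {zero}  x u≗v L≗L′ = ≡.refl
  creatorsExcept-cong {suc n} x u≗v L≗L′
    rewrite u≗v zero | L≗L′ zero | creatorsExcept-cong x (u≗v ∘ suc) (L≗L′ ∘ suc) = ≡.refl

  creatorsExcept-marked : ∀ {n} (u : Fin n → Bool) L x → (∀ l → u l ≡ true) → creatorsExcept u L x ≡ x
  creatorsExcept-marked {zero}  u L x marked = ≡.refl
  creatorsExcept-marked {suc n} u L x marked
    rewrite marked zero = creatorsExcept-marked (u ∘ suc) (L ∘ suc) x (marked ∘ suc)

  creates-tabulate : ∀ {n} (L : Fin n → Fin K) x → creates (tabulate L) x ≡ creatorsExcept (λ _ → false) L x
  creates-tabulate {zero}  L x = ≡.refl
  creates-tabulate {suc n} L x = ≡.cong (a† (L zero)) (creates-tabulate (L ∘ suc) x)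

  precedingWeight : ∀ {n} → (Fin n → Bool) → (Fin n → Fin K) → Fin K → Fin n → Carrier
  precedingWeight u L s l = ∏.sum λ l′ → if does (l′ <? l) ∧ not (u l′) then q s (L l′) else 1#

  contractionTerm : ∀ {n} → (Fin n → Bool) → (Fin n → Fin K) → Fin K → LinearForm → Fin n → Carrier
  contractionTerm u L s Φ l =
    if not (u l) ∧ does (s ≟ L l)
    then precedingWeight u L s l * φ Φ (creatorsExcept (mark u l) L vac)
    else 0#

  a-creatorsExcept : ∀ {n} (u : Fin n → Bool) L s Φ →
    φ Φ (a s (creatorsExcept u L vac)) ≈ ∑.sum (contractionTerm u L s Φ)
  a-creatorsExcept {zero}  u L s Φ = trans (φ-cong Φ (a-vac s)) (φ-0ᴹ Φ)
  a-creatorsExcept {suc n} u L s Φ = a-creatorsExcept-◂ (u zero) (u ∘ suc) (L zero) (L ∘ suc) Φ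
    where
    -- The goal only inspects u and L at zero and at successors, where they agree definitionally with
    -- u zero ◂ u ∘ suc and L zero ◂ L ∘ suc; naming the heads lets us case on the first creator.
    a-creatorsExcept-◂ : ∀ b (u : Fin n → Bool) t L Φ →
      φ Φ (a s (creatorsExcept (b ◂ u) (t ◂ L) vac)) ≈ ∑.sum (contractionTerm (b ◂ u) (t ◂ L) s Φ)
    a-creatorsExcept-◂ true u t L Φ = begin
      φ Φ (a s (creatorsExcept u L vac))                   ≈⟨ a-creatorsExcept u L s Φ ⟩
      ∑.sum (contractionTerm u L s Φ)                      ≈⟨ ∑.sum-cong-≋ skipFirst ⟨
      ∑.sum (contractionTerm (true ◂ u) (t ◂ L) s Φ ∘ suc) ≈⟨ +-identityˡ _ ⟨
      ∑.sum (contractionTerm (true ◂ u) (t ◂ L) s Φ)       ∎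
      where
      skipFirst : ∀ l → contractionTerm (true ◂ u) (t ◂ L) s Φ (suc l) ≈ contractionTerm u L s Φ l
      skipFirst l = if-cong (not (u l) ∧ does (s ≟ L l)) (*-congʳ (*-identityˡ _))
    a-creatorsExcept-◂ false u t L Φ = begin
      φ Φ (a s (a† t y))
        ≈⟨ φ-cong Φ (comm s t y) ⟩
      φ Φ ((q s t *ₗ a† t (a s y)) +ᴹ kronecker {k = K} M s t y)
        ≈⟨ φ-+ Φ _ _ ⟩
      φ Φ (q s t *ₗ a† t (a s y)) + φ Φ (kronecker {k = K} M s t y)
        ≈⟨ +-cong (φ-* Φ _ _) (φ-kronecker Φ s t y) ⟩
      q s t * φ (Φ ∘a† t) (a s y) + D
        ≈⟨ +-congʳ (*-congˡ (a-creatorsExcept u L s (Φ ∘a† t))) ⟩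
      q s t * ∑.sum (contractionTerm u L s (Φ ∘a† t)) + D
        ≈⟨ +-congʳ (*-distribˡ-sum (q s t) (contractionTerm u L s (Φ ∘a† t))) ⟩
      ∑.sum (λ l → q s t * contractionTerm u L s (Φ ∘a† t) l) + D
        ≈⟨ +-congʳ (∑.sum-cong-≋ {n} pushWeight) ⟩
      ∑.sum (contractionTerm (false ◂ u) (t ◂ L) s Φ ∘ suc) + D
        ≈⟨ +-comm _ _ ⟩
      D + ∑.sum (contractionTerm (false ◂ u) (t ◂ L) s Φ ∘ suc)
        ≈⟨ +-congʳ (if-cong (does (s ≟ t)) emptyWeight) ⟩
      ∑.sum (contractionTerm (false ◂ u) (t ◂ L) s Φ) ∎
      where
      y : Carrierᴹ
      y = creatorsExcept u L vac
      D : Carrier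
      D = if does (s ≟ t) then φ Φ y else 0#
      pushWeight : ∀ l → q s t * contractionTerm u L s (Φ ∘a† t) l ≈
                         contractionTerm (false ◂ u) (t ◂ L) s Φ (suc l)
      pushWeight l = trans (*-distribˡ-if (not (u l) ∧ does (s ≟ L l)) _ _)
                           (if-cong (not (u l) ∧ does (s ≟ L l)) (sym (*-assoc _ _ _)))
      emptyWeight : φ Φ y ≈ precedingWeight (false ◂ u) (t ◂ L) s zero * φ Φ y
      emptyWeight = sym (trans (*-congʳ (trans (*-identityˡ _) (∏.sum-replicate-zero n))) (*-identityˡ _))

module Contractions {c ℓ} (R : CommutativeRing c ℓ) {K : ℕ} (q : Fin K → Fin K → CommutativeRing.Carrier R)
  {N : ℕ} (d : Fin N → Fin K) (τ : Permutation′ N) where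

  open CommutativeRing R hiding (zero)
  open RingSums R
  open import Relation.Binary.Reasoning.Setoid setoid

  τʳ τˡ : Fin N → Fin N
  τʳ = τ ⟨$⟩ʳ_
  τˡ = τ ⟨$⟩ˡ_

  τʳ-injective : ∀ {x y} → τʳ x ≡ τʳ y → x ≡ y
  τʳ-injective eq = ≡.trans (≡.sym (inverseˡ τ)) (≡.trans (≡.cong τˡ eq) (inverseˡ τ))

  IsContraction : ∀ {n} → (Fin N → Bool) → (Fin n → Fin K) → (Fin n → Fin N) → Set
  IsContraction U s f = (∀ i j → f i ≡ f j → i ≡ j) × (∀ i → U (f i) ≡ false) × (∀ i → s i ≡ d (f i))

  contraction? : ∀ {n} U s (f : Fin n → Fin N) → Dec (IsContraction U s f)
  contraction? U s f =
    all? (λ i → all? λ j → (f i ≟ f j) →-dec (i ≟ j))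
    ×-dec all? (λ i → U (f i) Bool.≟ false)
    ×-dec all? (λ i → s i ≟ d (f i))

  contraction-consF : ∀ {n} U (s : Fin (suc n) → Fin K) x g →
    IsContraction U s (consF x g) ⇔ (T (not (U x)) × s zero ≡ d x × IsContraction (mark U x) (s ∘ suc) g)
  contraction-consF U s x g = mk⇔ split join
    where
    split : IsContraction U s (consF x g) →
            T (not (U x)) × s zero ≡ d x × IsContraction (mark U x) (s ∘ suc) g
    split (inj , free , coloured) =
      Equivalence.from T-not-≡ (free zero) , coloured zero ,
      (λ i j eq → Fin-suc-injective (inj (suc i) (suc j) eq)) , free′ , coloured ∘ suc
      where
      free′ : ∀ i → mark U x (g i) ≡ false
      free′ i with g i ≟ x
      ... | yes eq with () ← inj (suc i) zero eq
      ... | no _   = free (suc i)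
    join : T (not (U x)) × s zero ≡ d x × IsContraction (mark U x) (s ∘ suc) g →
           IsContraction U s (consF x g)
    join (x-free , x-coloured , inj , free , coloured) = inj′ , free′ , coloured′
      where
      g≢x : ∀ i → g i ≡ x → ⊥
      g≢x i eq with g i ≟ x | free i
      ... | no neq | _ = neq eq
      inj′ : ∀ i j → consF x g i ≡ consF x g j → i ≡ j
      inj′ zero    zero    _  = ≡.refl
      inj′ zero    (suc j) eq = ⊥-elim (g≢x j (≡.sym eq))
      inj′ (suc i) zero    eq = ⊥-elim (g≢x i eq)
      inj′ (suc i) (suc j) eq = ≡.cong suc (inj i j eq)
      free′ : ∀ i → U (consF x g i) ≡ false
      free′ zero    = Equivalence.to T-not-≡ x-free
      free′ (suc i) with g i ≟ x | free i
      ... | no _ | e = e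
      coloured′ : ∀ i → s i ≡ d (consF x g i)
      coloured′ zero    = x-coloured
      coloured′ (suc i) = coloured i

  contraction?-consF : ∀ {n} U (s : Fin (suc n) → Fin K) x g →
    does (contraction? U s (consF x g)) ≡ (not (U x) ∧ does (s zero ≟ d x)) ∧ does (contraction? (mark U x) (s ∘ suc) g)
  contraction?-consF U s x g =
    ≡.trans (does-⇔ (contraction-consF U s x g) (contraction? U s (consF x g))
                    (T? (not (U x)) ×-dec (s zero ≟ d x) ×-dec contraction? (mark U x) (s ∘ suc) g))
            (≡.sym (∧-assoc (not (U x)) _ _))

  crossing : Fin N → Fin N → Carrier
  crossing x y = if does (τˡ y <? τˡ x) then q (d x) (d y) else 1#

  inversionWeight : ∀ {n} → (Fin n → Fin N) → Carrier
  inversionWeight f = ∏.sum λ i → ∏.sum λ j →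
    if does (i <? j) ∧ does (τˡ (f j) <? τˡ (f i)) then q (d (f i)) (d (f j)) else 1#

  inversionWeight-consF : ∀ {n} x (g : Fin n → Fin N) →
    inversionWeight (consF x g) ≈ ∏.sum (crossing x ∘ g) * inversionWeight g
  inversionWeight-consF {n} x g = *-cong (*-identityˡ _) (∏.sum-cong-≋ {n} λ i → *-identityˡ _)

  crossingsBefore : (Fin N → Bool) → Fin K → Fin N → Carrier
  crossingsBefore U s x = ∏.sum λ y → if does (τˡ y <? τˡ x) ∧ not (U y) then q s (d y) else 1#

  crossingsBefore-mark : ∀ U x → crossingsBefore U (d x) x ≈ ∏.sum (λ y → if not (mark U x y) then crossing x y else 1#)
  crossingsBefore-mark U x = ∏.sum-cong-≋ pointwise
    where
    pointwise : ∀ y → (if does (τˡ y <? τˡ x) ∧ not (U y) then q (d x) (d y) else 1#)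
                    ≈ (if not (mark U x y) then crossing x y else 1#)
    pointwise y with y ≟ x
    ... | yes ≡.refl rewrite dec-false (τˡ y <? τˡ y) (<-irrefl ≡.refl) = refl
    ... | no _ with does (τˡ y <? τˡ x) | U y
    ...   | true  | true  = refl
    ...   | true  | false = refl
    ...   | false | true  = refl
    ...   | false | false = refl

  crossingsBefore-absorb : ∀ {n} U (s : Fin (suc n) → Fin K) x (g : Fin n → Fin N) →
    unmarked U ≡ suc n → U x ≡ false → s zero ≡ d x → IsContraction (mark U x) (s ∘ suc) g →
    crossingsBefore U (s zero) x * inversionWeight g ≈ inversionWeight (consF x g)
  crossingsBefore-absorb {n} U s x g count x-unmarked x-coloured (inj , free , _) = begin
    crossingsBefore U (s zero) x * inversionWeight g
      ≡⟨ ≡.cong (λ t → crossingsBefore U t x * inversionWeight g) x-coloured ⟩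
    crossingsBefore U (d x) x * inversionWeight g
      ≈⟨ *-congʳ (crossingsBefore-mark U x) ⟩
    ∏.sum (λ y → if not (mark U x y) then crossing x y else 1#) * inversionWeight g
      ≈⟨ *-congʳ (∏.sum-enumeration (mark U x) (crossing x) g inj free count′) ⟨
    ∏.sum (crossing x ∘ g) * inversionWeight g
      ≈⟨ inversionWeight-consF x g ⟨
    inversionWeight (consF x g) ∎
    where
    count′ : unmarked (mark U x) ≡ n
    count′ = suc-injective (≡.trans (≡.sym (unmarked-mark U x x-unmarked)) count)

  contractionWeight : ∀ {n} → (Fin N → Bool) → (Fin n → Fin K) → (Fin n → Fin N) → Carrier
  contractionWeight U s f = if does (contraction? U s f) then inversionWeight f else 0#

module Wick {c ℓ m ℓm} (R : CommutativeRing c ℓ) {K : ℕ}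
  {q : Fin K → Fin K → CommutativeRing.Carrier R} (A : QRep R m ℓm K q)
  {N : ℕ} (d : Fin N → Fin K) (τ : Permutation′ N) where

  open CommutativeRing R hiding (zero)
  open RingSums R
  open QRep A using (a; bra; vac; annihilates; bra-vac)
  open NormalOrdering R A
  open LinearForm
  open Contractions R q d τ
  open import Relation.Binary.Reasoning.Setoid setoid

  colour : Fin N → Fin K
  colour = d ∘ τʳ

  particleTerm : (Fin N → Bool) → Fin K → LinearForm → Fin N → Carrier
  particleTerm U s Φ x =
    if not (U x) ∧ does (s ≟ d x)
    then crossingsBefore U s x * φ Φ (creatorsExcept (mark U x ∘ τʳ) colour vac)
    else 0#

  contractionTerm-particle : ∀ U s Φ l → contractionTerm (U ∘ τʳ) colour s Φ l ≈ particleTerm U s Φ (τʳ l)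
  contractionTerm-particle U s Φ l = if-cong (not (U (τʳ l)) ∧ does (s ≟ colour l)) (*-cong weight creators)
    where
    earlier : ∀ l′ → does (l′ <? l) ≡ does (τˡ (τʳ l′) <? τˡ (τʳ l))
    earlier l′ rewrite inverseˡ τ {l′} | inverseˡ τ {l} = ≡.refl
    weight : precedingWeight (U ∘ τʳ) colour s l ≈ crossingsBefore U s (τʳ l)
    weight = begin
      precedingWeight (U ∘ τʳ) colour s l
        ≡⟨ ∏.sum-cong-≗ (λ l′ → ≡.cong (λ b → if b ∧ not (U (τʳ l′)) then q s (colour l′) else 1#) (earlier l′)) ⟩
      ∏.sum (λ l′ → if does (τˡ (τʳ l′) <? τˡ (τʳ l)) ∧ not (U (τʳ l′)) then q s (colour l′) else 1#)
        ≈⟨ ∏.sum-permute _ τ ⟨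
      crossingsBefore U s (τʳ l) ∎
    sameMark : mark (U ∘ τʳ) l ≗ mark U (τʳ l) ∘ τʳ
    sameMark l′ = ≡.cong (_∨ U (τʳ l′)) (does-⇔ (mk⇔ (≡.cong τʳ) τʳ-injective) (l′ ≟ l) (τʳ l′ ≟ τʳ l))
    creators : φ Φ (creatorsExcept (mark (U ∘ τʳ) l) colour vac) ≈
               φ Φ (creatorsExcept (mark U (τʳ l) ∘ τʳ) colour vac)
    creators = reflexive (≡.cong (φ Φ) (creatorsExcept-cong vac sameMark λ _ → ≡.refl))

  VevFormula : ∀ {n} → (Fin n → Fin K) → Set ℓ
  VevFormula {n} s = ∀ U → unmarked U ≡ n →
    bra (annihilates (tabulate s) (creatorsExcept (U ∘ τʳ) colour vac)) ≈ ∑.fold (allMaps n N) (contractionWeight U s)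

  particleTerm-contractions : ∀ {n} (s : Fin (suc n) → Fin K) → VevFormula (s ∘ suc) →
    ∀ U x → unmarked U ≡ suc n →
    particleTerm U (s zero) (braAfter (tabulate (s ∘ suc))) x ≈
    ∑.fold (allMaps n N) (λ g → contractionWeight U s (consF x g))
  particleTerm-contractions {n} s vev-tail U x count = begin
    particleTerm U (s zero) Φ x
      ≈⟨ if-fold-∧ headContracts (allMaps n N) tailContracts (inversionWeight ∘ consF x) contract ⟩
    ∑.fold (allMaps n N) (λ g → if headContracts ∧ tailContracts g then inversionWeight (consF x g) else 0#)
      ≈⟨ ∑.fold-cong (allMaps n N) (λ g → reflexive (≡.cong (λ b → if b then inversionWeight (consF x g) else 0#)
                                                               (contraction?-consF U s x g))) ⟨
    ∑.fold (allMaps n N) (λ g → contractionWeight U s (consF x g)) ∎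
    where
    Φ : LinearForm
    Φ = braAfter (tabulate (s ∘ suc))
    headContracts : Bool
    headContracts = not (U x) ∧ does (s zero ≟ d x)
    tailContracts : (Fin n → Fin N) → Bool
    tailContracts g = does (contraction? (mark U x) (s ∘ suc) g)
    contract : T headContracts →
               crossingsBefore U (s zero) x * φ Φ (creatorsExcept (mark U x ∘ τʳ) colour vac) ≈
               ∑.fold (allMaps n N) (λ g → if tailContracts g then inversionWeight (consF x g) else 0#)
    contract head = begin
      κ * φ Φ (creatorsExcept (mark U x ∘ τʳ) colour vac)
        ≈⟨ *-congˡ (trans (reflexive (braAfter-annihilates (tabulate (s ∘ suc)) _)) (vev-tail (mark U x) count′)) ⟩
      κ * ∑.fold (allMaps n N) (contractionWeight (mark U x) (s ∘ suc))
        ≈⟨ *-distribˡ-fold κ (allMaps n N) _ ⟩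
      ∑.fold (allMaps n N) (λ g → κ * contractionWeight (mark U x) (s ∘ suc) g)
        ≈⟨ ∑.fold-cong (allMaps n N) absorb ⟩
      ∑.fold (allMaps n N) (λ g → if tailContracts g then inversionWeight (consF x g) else 0#) ∎
      where
      κ : Carrier
      κ = crossingsBefore U (s zero) x
      x-unmarked : U x ≡ false
      x-unmarked = proj₁ (T-not-∧-does (U x) (s zero ≟ d x) head)
      x-coloured : s zero ≡ d x
      x-coloured = proj₂ (T-not-∧-does (U x) (s zero ≟ d x) head)
      count′ : unmarked (mark U x) ≡ n
      count′ = suc-injective (≡.trans (≡.sym (unmarked-mark U x x-unmarked)) count)
      absorb : ∀ g → κ * (if tailContracts g then inversionWeight g else 0#) ≈
                     (if tailContracts g then inversionWeight (consF x g) else 0#)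
      absorb g = absorbIf (contraction? (mark U x) (s ∘ suc) g)
        where
        absorbIf : (γ? : Dec (IsContraction (mark U x) (s ∘ suc) g)) →
                   κ * (if does γ? then inversionWeight g else 0#) ≈ (if does γ? then inversionWeight (consF x g) else 0#)
        absorbIf (yes γ) = crossingsBefore-absorb U s x g count x-unmarked x-coloured γ
        absorbIf (no _)  = zeroʳ κ

  vev-creatorsExcept : ∀ {n} (s : Fin n → Fin K) → VevFormula s
  vev-creatorsExcept {zero} s U none = begin
    bra (creatorsExcept (U ∘ τʳ) colour vac)
      ≡⟨ ≡.cong bra (creatorsExcept-marked (U ∘ τʳ) colour vac (unmarked≡0⇒marked U none ∘ τʳ)) ⟩
    bra vac                                  ≈⟨ bra-vac ⟩
    1#                                       ≈⟨ +-identityʳ 1# ⟨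
    ∑.fold (allMaps zero N) (contractionWeight U s) ∎
  vev-creatorsExcept {suc n} s U count = begin
    bra (annihilates (tabulate (s ∘ suc)) (a (s zero) (creatorsExcept (U ∘ τʳ) colour vac)))
      ≡⟨ braAfter-annihilates (tabulate (s ∘ suc)) (a (s zero) (creatorsExcept (U ∘ τʳ) colour vac)) ⟨
    φ Φ (a (s zero) (creatorsExcept (U ∘ τʳ) colour vac)) ≈⟨ a-creatorsExcept (U ∘ τʳ) colour (s zero) Φ ⟩
    ∑.sum (contractionTerm (U ∘ τʳ) colour (s zero) Φ)     ≈⟨ ∑.sum-cong-≋ (contractionTerm-particle U (s zero) Φ) ⟩
    ∑.sum (particleTerm U (s zero) Φ ∘ τʳ)                 ≈⟨ ∑.sum-permute (particleTerm U (s zero) Φ) τ ⟨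
    ∑.sum (particleTerm U (s zero) Φ)
      ≈⟨ ∑.sum-cong-≋ (λ x → particleTerm-contractions s (vev-creatorsExcept (s ∘ suc)) U x count) ⟩
    ∑.sum (λ x → ∑.fold (allMaps n N) (λ g → contractionWeight U s (consF x g)))
      ≈⟨ ∑.fold-∑-comm (allMaps n N) (λ g x → contractionWeight U s (consF x g)) ⟨
    ∑.fold (allMaps n N) (λ g → ∑.sum (λ x → contractionWeight U s (consF x g)))
      ≈⟨ ∑.fold-allMaps n N (contractionWeight U s) ⟨
    ∑.fold (allMaps (suc n) N) (contractionWeight U s) ∎
    where
    Φ : LinearForm
    Φ = braAfter (tabulate (s ∘ suc))

open import Data.Nat.ListAction using (sum)

module Chambers {c ℓ} (R : CommutativeRing c ℓ) (ps : List ℕ)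
  (q : Fin (length ps) → Fin (length ps) → CommutativeRing.Carrier R) (τ : Permutation′ (sum ps)) where

  open CommutativeRing R hiding (zero)
  open RingSums R
  open Weights R using (vChamber; vWord; inversionPair?)
  open Contractions R q (dot ps) τ
  open import Relation.Binary.Reasoning.Setoid setoid

  inversionWeight≈vChamber : ∀ σ → inversionWeight σ ≈ vChamber ps q σ τ
  inversionWeight≈vChamber σ = sym (begin
    vChamber ps q σ τ                          ≈⟨ ∏.fold-filter (inversionPair? ps q σ τ) (pairs N) F ⟩
    ∏.fold (pairs N) G                         ≈⟨ ∏.fold-concatMap row (allFin N) G ⟩
    ∏.fold (allFin N) (λ i → ∏.fold (row i) G) ≈⟨ ∏.fold-tabulate id (λ i → ∏.fold (row i) G) ⟩
    ∏.sum (λ i → ∏.fold (row i) G)             ≈⟨ ∏.sum-cong-≋ rowProduct ⟩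
    inversionWeight σ                          ∎)
    where
    N : ℕ
    N = sum ps
    F : Fin N × Fin N → Carrier
    F (i , j) = q (dot ps (σ i)) (dot ps (σ j))
    G : Fin N × Fin N → Carrier
    G p = if does (inversionPair? ps q σ τ p) then F p else 1#
    row : Fin N → List (Fin N × Fin N)
    row i = map (i ,_) (allFin N)
    rowProduct : ∀ i → ∏.fold (row i) G ≈ ∏.sum (λ j → G (i , j))
    rowProduct i = trans (∏.fold-map (i ,_) (allFin N) G) (∏.fold-tabulate id (λ j → G (i , j)))

  contractionIsFibre : ∀ σ̇ σ → IsContraction (λ _ → false) σ̇ σ ⇔ InFibre ps σ̇ σ
  contractionIsFibre σ̇ σ =
    mk⇔ (λ (inj , _ , coloured) → inj , ≡.sym ∘ coloured) (λ (inj , fibre) → inj , (λ _ → ≡.refl) , ≡.sym ∘ fibre)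

  contractions≈vWord : ∀ σ̇ → ∑.fold (allMaps (sum ps) (sum ps)) (contractionWeight (λ _ → false) σ̇) ≈ vWord ps q σ̇ τ
  contractions≈vWord σ̇ = begin
    ∑.fold (allMaps (sum ps) (sum ps)) (contractionWeight (λ _ → false) σ̇)
      ≈⟨ ∑.fold-cong (allMaps (sum ps) (sum ps)) chamber ⟩
    ∑.fold (allMaps (sum ps) (sum ps)) (λ σ → if does (inFibre? ps σ̇ σ) then vChamber ps q σ τ else 0#)
      ≈⟨ ∑.fold-filter (inFibre? ps σ̇) (allMaps (sum ps) (sum ps)) (λ σ → vChamber ps q σ τ) ⟨
    vWord ps q σ̇ τ ∎
    where
    chamber : ∀ σ → contractionWeight (λ _ → false) σ̇ σ ≈ (if does (inFibre? ps σ̇ σ) then vChamber ps q σ τ else 0#)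
    chamber σ = trans
      (reflexive (≡.cong (λ b → if b then inversionWeight σ else 0#)
        (does-⇔ (contractionIsFibre σ̇ σ) (contraction? (λ _ → false) σ̇ σ) (inFibre? ps σ̇ σ))))
      (if-cong (does (inFibre? ps σ̇ σ)) (inversionWeight≈vChamber σ))

lemma3p4 : ∀ {c ℓ m ℓm : Level} (R : CommutativeRing c ℓ)
    (ps : List ℕ) → IsPartition ps →
    (q : Fin (length ps) → Fin (length ps) → CommutativeRing.Carrier R)
    (A : QRep R m ℓm (length ps) q)
    (σ̇ τ̇ : Fin (sum ps) → Fin (length ps)) → In𝔖I ps σ̇ → In𝔖I ps τ̇ →
    (τ : Permutation′ (sum ps)) → InFibreP ps τ̇ τ →
    CommutativeRing._≈_ R
    (QRep.vev A (tabulate σ̇) (tabulate τ̇))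
    (Weights.vWord R ps q σ̇ τ)
lemma3p4 R ps _ q A σ̇ τ̇ _ _ τ τ-fibre = begin
  bra (annihilates (tabulate σ̇) (creates (tabulate τ̇) vac))
    ≡⟨ ≡.cong (bra ∘ annihilates (tabulate σ̇)) creationString ⟩
  bra (annihilates (tabulate σ̇) (creatorsExcept (λ _ → false) colour vac))
    ≈⟨ vev-creatorsExcept σ̇ (λ _ → false) (unmarked-none (sum ps)) ⟩
  ∑.fold (allMaps (sum ps) (sum ps)) (contractionWeight (λ _ → false) σ̇)
    ≈⟨ contractions≈vWord σ̇ ⟩
  Weights.vWord R ps q σ̇ τ ∎
  where
  open CommutativeRing R using (setoid)
  open RingSums R using (module ∑)
  open QRep A using (bra; annihilates; creates; vac)
  open NormalOrdering R A using (creates-tabulate; creatorsExcept; creatorsExcept-cong)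
  open Contractions R q (dot ps) τ using (contractionWeight)
  open Wick R A (dot ps) τ using (colour; vev-creatorsExcept)
  open Chambers R ps q τ using (contractions≈vWord)
  open import Relation.Binary.Reasoning.Setoid setoid
  creationString : creates (tabulate τ̇) vac ≡ creatorsExcept (λ _ → false) colour vac
  creationString = ≡.trans (creates-tabulate τ̇ vac) (creatorsExcept-cong vac (λ _ → ≡.refl) (≡.sym ∘ τ-fibre))
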